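{- Let $G$ be a chordal graph, let $v$ be a simplicial vertex of $G$, and let $G'=G-v$. If $a,b\in V(G')$ are two vertices such that $\{a,b\}$ monitors an edge $e$ in $G'$, then $\{a,b\}$ monitors $e$ in $G$.
   Context: A vertex is simplicial if its neighbourhood is a clique. For a graph $H$, an edge $e$ of $H$ and vertices $a,b$ of $H$, the pair $\{a,b\}$ monitors $e$ in $H$ if $e$ lies on every shortest path between $a$ and $b$ in $H$. A graph is chordal if it has no induced cycle of length at least $4$. -}

module Defs where

open import Data.Nat using (ℕ; zero; suc; _≤_)
open import Data.Fin using (Fin; zero; suc; inject₁; punchIn)
open import Data.Bool using (Bool; true; false)
open import Data.Product using (Σ; _×_; _,_; ∃-syntax)
open import Data.Sum using (_⊎_)
open import Relation.Binary.PropositionalEquality using (_≡_; _≢_)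
open import Function.Definitions using (Injective)
open import Data.Nat.Base using (_≥_)

record Graph (n : ℕ) : Set where
  field
    adj   : Fin n → Fin n → Bool
    sym   : ∀ x y → adj x y ≡ adj y x
    irrefl : ∀ x → adj x x ≡ false
open Graph public

Adj : ∀ {n} → Graph n → Fin n → Fin n → Set
Adj G x y = adj G x y ≡ true

-- Vertex deletion G - v : vertices of G - v are Fin n, embedded via punchIn v.
delete : ∀ {n} → Graph (suc n) → Fin (suc n) → Graph n
delete G v = record
  { adj = λ x y → adj G (punchIn v x) (punchIn v y)
  ; sym = λ x y → sym G (punchIn v x) (punchIn v y)
  ; irrefl = λ x → irrefl G (punchIn v x) }

Simplicial : ∀ {n} → Graph n → Fin n → Set
Simplicial G v = ∀ x y → Adj G v x → Adj G v y → x ≢ y → Adj G x y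

sucMod : ∀ {k} → Fin (suc k) → Fin (suc k)
sucMod {zero} i = zero
sucMod {suc k} zero = suc zero
sucMod {suc k} (suc i) with sucMod {k} i
... | zero = zero
... | suc j = suc (suc j)

InducedCycle : ∀ {n} → Graph n → (k : ℕ) → Set
InducedCycle {n} G zero = Data.Empty.⊥ where import Data.Empty
InducedCycle {n} G (suc k) =
  Σ (Fin (suc k) → Fin n) λ c →
    Injective _≡_ _≡_ c ×
    (∀ i j → (Adj G (c i) (c j) → (j ≡ sucMod i ⊎ i ≡ sucMod j)) ×
             ((j ≡ sucMod i ⊎ i ≡ sucMod j) → Adj G (c i) (c j)))

Chordal : ∀ {n} → Graph n → Set
Chordal G = ∀ k → k ≥ 4 → InducedCycle G k → Data.Empty.⊥ where import Data.Empty

record Path {n} (G : Graph n) (a b : Fin n) (k : ℕ) : Set where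
  field
    vtx   : Fin (suc k) → Fin n
    start : vtx zero ≡ a
    end   : vtx (Data.Fin.fromℕ k) ≡ b
    steps : ∀ (i : Fin k) → Adj G (vtx (inject₁ i)) (vtx (suc i))
    distinct : Injective _≡_ _≡_ vtx
open Path public

record ShortestPath {n} (G : Graph n) (a b : Fin n) (k : ℕ) : Set where
  field
    path : Path G a b k
    minimal : ∀ k' → Path G a b k' → k ≤ k'
open ShortestPath public

EdgeOn : ∀ {n} {G : Graph n} {a b k} → Path G a b k → Fin n → Fin n → Set
EdgeOn {k = k} P x y =
  ∃[ i ] ((vtx P (inject₁ {k} i) ≡ x × vtx P (suc i) ≡ y) ⊎
          (vtx P (inject₁ {k} i) ≡ y × vtx P (suc i) ≡ x))

Monitors : ∀ {n} → Graph n → Fin n → Fin n → Fin n → Fin n → Set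
Monitors G a b x y = ∀ k (P : ShortestPath G a b k) → EdgeOn (path P) x y

{-# OPTIONS --safe #-}
-- A simplicial vertex v is never an interior vertex of a shortest path: its two
-- neighbours on the path are adjacent, so skipping v gives a shorter path.  Hence
-- every shortest a–b path of G lies in G − v, where it is again shortest and
-- therefore contains e.
module Submission where

open import Defs
open import Data.Nat using (suc)
open import Data.Fin using (Fin; punchIn)

open import Data.Nat using (zero)
open import Data.Nat.Properties using (1+n≰n)
open import Data.Fin using (zero; suc; fromℕ; inject₁; punchOut)
open import Data.Fin.Properties using (suc-injective; punchIn-injective; punchInᵢ≢i; punchIn-punchOut)
open import Data.Product using (_,_; ∃-syntax; _×_)
open import Data.Sum using (_⊎_; inj₁; inj₂)
open import Function using (_∘_)
open import Relation.Binary.PropositionalEquality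
  using (_≡_; _≢_; refl; trans; cong; subst₂; ≢-sym)
  renaming (sym to ≡-sym)

punchIn-fromℕ : ∀ {n} (i : Fin (suc n)) → punchIn (inject₁ i) (fromℕ n) ≡ fromℕ (suc n)
punchIn-fromℕ zero = refl
punchIn-fromℕ {suc n} (suc i) = cong suc (punchIn-fromℕ i)

inject₁²≢suc² : ∀ {n} (j : Fin n) → inject₁ (inject₁ j) ≢ suc (suc j)
inject₁²≢suc² zero ()
inject₁²≢suc² (suc j) eq = inject₁²≢suc² j (suc-injective eq)

-- Punching in the hole suc (inject₁ j) keeps consecutive indices consecutive,
-- except at j, where they straddle the hole.
punchIn-consecutive : ∀ {m} (j t : Fin m) →
  (∃[ s ] punchIn (suc (inject₁ j)) (inject₁ t) ≡ inject₁ s ×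
          punchIn (suc (inject₁ j)) (suc t) ≡ suc s) ⊎
  (punchIn (suc (inject₁ j)) (inject₁ t) ≡ inject₁ (inject₁ j) ×
   punchIn (suc (inject₁ j)) (suc t) ≡ suc (suc j))
punchIn-consecutive zero    zero    = inj₂ (refl , refl)
punchIn-consecutive zero    (suc t) = inj₁ (suc (suc t) , refl , refl)
punchIn-consecutive (suc j) zero    = inj₁ (zero , refl , refl)
punchIn-consecutive (suc j) (suc t) with punchIn-consecutive j t
... | inj₁ (s , p , q) = inj₁ (suc s , cong suc p , cong suc q)
... | inj₂ (p , q)     = inj₂ (cong suc p , cong suc q)

data Position : ∀ {k} → Fin (suc k) → Set where
  first    : ∀ {k} → Position {k} zero
  last     : ∀ {k} → Position (fromℕ k)
  interior : ∀ {m} (j : Fin m) → Position {suc m} (suc (inject₁ j))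

position : ∀ {k} (i : Fin (suc k)) → Position i
position zero = first
position {suc zero} (suc zero) = last
position {suc (suc m)} (suc i) with position i
... | first      = interior zero
... | last       = last
... | interior j = interior (suc j)

module _ {n} {G : Graph n} where

  Adj-sym : ∀ {x y} → Adj G x y → Adj G y x
  Adj-sym {x} {y} xy = trans (Graph.sym G y x) xy

  skip : ∀ {a b m} (P : Path G a b (suc m)) (j : Fin m) →
         Adj G (vtx P (inject₁ (inject₁ j))) (vtx P (suc (suc j))) → Path G a b m
  skip P j shortcut = record
    { vtx      = vtx P ∘ punchIn hole
    ; start    = start P
    ; end      = trans (cong (vtx P) (punchIn-fromℕ (suc j))) (end P)
    ; steps    = step
    ; distinct = punchIn-injective hole _ _ ∘ distinct P
    }
    where
      hole = suc (inject₁ j)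
      step : ∀ t → Adj G (vtx P (punchIn hole (inject₁ t))) (vtx P (punchIn hole (suc t)))
      step t with punchIn-consecutive j t
      ... | inj₁ (s , p , q) = subst₂ (λ u w → Adj G (vtx P u) (vtx P w)) (≡-sym p) (≡-sym q) (steps P s)
      ... | inj₂ (p , q)     = subst₂ (λ u w → Adj G (vtx P u) (vtx P w)) (≡-sym p) (≡-sym q) shortcut

  shortest-avoids-simplicial : ∀ {v a b k} → Simplicial G v → (P : ShortestPath G a b k) →
                               a ≢ v → b ≢ v → ∀ i → vtx (path P) i ≢ v
  shortest-avoids-simplicial {v} simplicial P a≢v b≢v i = go (position i)
    where
      go : ∀ {i} → Position i → vtx (path P) i ≢ v
      go first        eq = a≢v (trans (≡-sym (start (path P))) eq)
      go last         eq = b≢v (trans (≡-sym (end (path P))) eq)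
      go (interior {m} j) eq = 1+n≰n (minimal P m (skip (path P) j shortcut))
        where
          before = vtx (path P) (inject₁ (inject₁ j))
          after  = vtx (path P) (suc (suc j))
          v~before : Adj G v before
          v~before = Adj-sym (subst₂ (Adj G) refl eq (steps (path P) (inject₁ j)))
          v~after : Adj G v after
          v~after = subst₂ (Adj G) eq refl (steps (path P) (suc j))
          shortcut : Adj G before after
          shortcut = simplicial _ _ v~before v~after (inject₁²≢suc² j ∘ distinct (path P))

module _ {n} {G : Graph (suc n)} {v : Fin (suc n)} where

  lift : ∀ {a b k} → Path (delete G v) a b k → Path G (punchIn v a) (punchIn v b) k
  lift Q = record
    { vtx      = punchIn v ∘ vtx Q
    ; start    = cong (punchIn v) (start Q)
    ; end      = cong (punchIn v) (end Q)
    ; steps    = steps Q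
    ; distinct = distinct Q ∘ punchIn-injective v _ _
    }

  module _ {a b k} (P : Path G (punchIn v a) (punchIn v b) k) (avoids : ∀ i → vtx P i ≢ v) where

    punchIn-punchOut-avoids : ∀ i → punchIn v (punchOut (≢-sym (avoids i))) ≡ vtx P i
    punchIn-punchOut-avoids i = punchIn-punchOut _

    restrict : Path (delete G v) a b k
    restrict = record
      { vtx      = λ i → punchOut (≢-sym (avoids i))
      ; start    = punchIn-injective v _ _ (trans (punchIn-punchOut-avoids zero) (start P))
      ; end      = punchIn-injective v _ _ (trans (punchIn-punchOut-avoids (fromℕ k)) (end P))
      ; steps    = λ i → subst₂ (Adj G) (≡-sym (punchIn-punchOut-avoids _))
                                        (≡-sym (punchIn-punchOut-avoids _)) (steps P i)
      ; distinct = λ eq → distinct P (trans (≡-sym (punchIn-punchOut-avoids _))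
                                       (trans (cong (punchIn v) eq) (punchIn-punchOut-avoids _)))
      }

    vtx-restrict : ∀ {i z} → vtx restrict i ≡ z → vtx P i ≡ punchIn v z
    vtx-restrict {i} eq = trans (≡-sym (punchIn-punchOut-avoids i)) (cong (punchIn v) eq)

    EdgeOn-restrict : ∀ {x y} → EdgeOn restrict x y → EdgeOn P (punchIn v x) (punchIn v y)
    EdgeOn-restrict (i , inj₁ (p , q)) = i , inj₁ (vtx-restrict p , vtx-restrict q)
    EdgeOn-restrict (i , inj₂ (p , q)) = i , inj₂ (vtx-restrict p , vtx-restrict q)

  restrict-shortest : ∀ {a b k} (P : ShortestPath G (punchIn v a) (punchIn v b) k) →
                      (avoids : ∀ i → vtx (path P) i ≢ v) → ShortestPath (delete G v) a b k
  restrict-shortest P avoids = record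
    { path    = restrict (path P) avoids
    ; minimal = λ k' Q → minimal P k' (lift Q)
    }

lemma4 : ∀ {n} (G : Graph (suc n)) (v : Fin (suc n)) → Chordal G → Simplicial G v →
    ∀ (a b x y : Fin n) → Adj (delete G v) x y → Monitors (delete G v) a b x y →
    Monitors G (punchIn v a) (punchIn v b) (punchIn v x) (punchIn v y)
lemma4 G v _ simplicial a b x y _ monitors k P =
  EdgeOn-restrict (path P) avoids (monitors k (restrict-shortest P avoids))
  where
    avoids : ∀ i → vtx (path P) i ≢ v
    avoids = shortest-avoids-simplicial simplicial P (punchInᵢ≢i v a) (punchInᵢ≢i v b)
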